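{- Let $K_1,\ldots,K_m$ be arbitrary simplicial complexes. Then $$q_{\partial\Delta_{[m]}(K_1,\ldots,K_m)}(t)=q_{K_1}(t)\cdot\ldots\cdot q_{K_m}(t).$$
   Context: A simplicial complex on a finite set $V$ is a family of subsets of $V$ closed under taking subsets (ghost vertices allowed). $\partial\Delta_{[m]}$ is the complex on $[m]$ of all proper subsets of $[m]$. For $K$ on $[m]$ and $K_i$ on $[l_i]$, the composition $K(K_1,\ldots,K_m)$ is the complex on $[l_1]\sqcup\cdots\sqcup[l_m]$ in which $I=I_1\sqcup\cdots\sqcup I_m$ is a simplex iff $\{i\mid I_i\notin K_i\}\in K$. For a complex $K$ of dimension $n-1$ with $f_i=|\{I\in K\mid |I|=i\}|$, $f_K(t)=\sum f_it^i$, the $h$-polynomial is $h_K(t)=(1-t)^nf_K\big(\tfrac{t}{1-t}\big)$; if $K$ has $m$ vertices (counting ghost vertices) and dimension $n-1$, set $q_K(t)=1-(1-t)^{m-n}h_K(t)$. -}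

module Defs where

open import Data.Nat using (ℕ; zero; suc; _+_; _∸_; _⊔_)
open import Data.Integer as ℤ using (ℤ; 0ℤ; 1ℤ)
open import Data.Bool using (Bool; true; false; if_then_else_)
import Data.Bool.Properties as BoolP
open import Data.Fin using (Fin; zero; suc; _↑ˡ_; _↑ʳ_)
open import Data.Fin.Subset using (Subset; inside; outside; _∈_; _⊆_; ⊤; ∣_∣)
open import Data.Fin.Subset.Properties using (⊆-antisym; ⊆-max)
open import Data.Vec using (Vec; []; _∷_; lookup; tabulate; sum; _[_]=_; here; there)
open import Data.Vec.Properties using (≡-dec; []=⇒lookup; lookup⇒[]=; lookup∘tabulate)
open import Data.List using (List; [_]; _++_; map; filter; length; foldr)
open import Data.Product using (_×_; _,_)
open import Relation.Unary using (Decidable)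
open import Relation.Nullary using (Dec; ¬_; does; yes; no; ¬?; _×-dec_)
open import Relation.Binary.PropositionalEquality using (_≡_; refl; trans; sym; subst)
open import Data.Empty using (⊥-elim)

-- Simplicial complexes on the vertex set [n] = Fin n (ghost vertices
-- allowed): a decidable family of subsets closed under taking subsets.

record Complex (n : ℕ) : Set₁ where
  field
    Face   : Subset n → Set
    face?  : Decidable Face
    closed : ∀ {I J} → J ⊆ I → Face I → Face J
open Complex public

allSubsets : ∀ n → List (Subset n)
allSubsets zero    = [ [] ]
allSubsets (suc n) = map (inside ∷_) (allSubsets n) ++ map (outside ∷_) (allSubsets n)

faces : ∀ {n} → Complex n → List (Subset n)
faces {n} K = filter (face? K) (allSubsets n)

fvec : ∀ {n} → Complex n → ℕ → ℕ
fvec {n} K i = length (filter (λ I → face? K I ×-dec (∣ I ∣ Data.Nat.≟ i)) (allSubsets n))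

-- dimK K = dim K + 1 = the largest cardinality of a simplex (0 if K has none).
dimK : ∀ {n} → Complex n → ℕ
dimK K = foldr (λ I r → ∣ I ∣ ⊔ r) 0 (faces K)

∂Δ : ∀ m → Complex m
∂Δ m = record
  { Face   = λ I → ¬ (I ≡ ⊤)
  ; face?  = λ I → ¬? (≡-dec BoolP._≟_ I ⊤)
  ; closed = λ {I} {J} J⊆I I≢⊤ J≡⊤ →
      I≢⊤ (⊆-antisym (⊆-max I) (λ x∈⊤ → J⊆I (subst (λ S → _ ∈ S) (sym J≡⊤) x∈⊤)))
  }

-- Composition K(K_1,…,K_m), with vertex set [l_1] ⊔ ⋯ ⊔ [l_m]
-- realised as Fin (l_1 + ⋯ + l_m) (the blocks consecutive, in order).

splitL : ∀ l {n} → Subset (l + n) → Subset l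
splitL zero    I       = []
splitL (suc l) (x ∷ I) = x ∷ splitL l I

splitR : ∀ l {n} → Subset (l + n) → Subset n
splitR zero    I       = I
splitR (suc l) (x ∷ I) = splitR l I

splitL-∈ : ∀ l {n} (I : Subset (l + n)) {x : Fin l} → x ∈ splitL l I → x ↑ˡ n ∈ I
splitL-∈ (suc l) (_ ∷ I) here        = here
splitL-∈ (suc l) (_ ∷ I) (there p)   = there (splitL-∈ l I p)

∈-splitL : ∀ l {n} (I : Subset (l + n)) {x : Fin l} → x ↑ˡ n ∈ I → x ∈ splitL l I
∈-splitL (suc l) (_ ∷ I) {zero}  here      = here
∈-splitL (suc l) (_ ∷ I) {suc x} (there p) = there (∈-splitL l I p)

splitR-∈ : ∀ l {n} (I : Subset (l + n)) {x : Fin n} → x ∈ splitR l I → l ↑ʳ x ∈ I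
splitR-∈ zero    I       p = p
splitR-∈ (suc l) (_ ∷ I) p = there (splitR-∈ l I p)

∈-splitR : ∀ l {n} (I : Subset (l + n)) {x : Fin n} → l ↑ʳ x ∈ I → x ∈ splitR l I
∈-splitR zero    I       p         = p
∈-splitR (suc l) (_ ∷ I) (there p) = ∈-splitR l I p

block : ∀ {m} (ls : Vec ℕ m) → Subset (sum ls) → (i : Fin m) → Subset (lookup ls i)
block (l ∷ ls) I zero    = splitL l I
block (l ∷ ls) I (suc i) = block ls (splitR l I) i

block-mono : ∀ {m} (ls : Vec ℕ m) {I J : Subset (sum ls)} → J ⊆ I → ∀ i → block ls J i ⊆ block ls I i
block-mono (l ∷ ls) {I} {J} J⊆I zero    p = ∈-splitL l I (J⊆I (splitL-∈ l J p))
block-mono (l ∷ ls) {I} {J} J⊆I (suc i) p =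
  block-mono ls (λ q → ∈-splitR l I (J⊆I (splitR-∈ l J q))) i p

defect : ∀ {m} (ls : Vec ℕ m) (Ks : (i : Fin m) → Complex (lookup ls i)) →
         Subset (sum ls) → Subset m
defect ls Ks I = tabulate (λ i → if does (face? (Ks i) (block ls I i)) then outside else inside)

defect-mono : ∀ {m} (ls : Vec ℕ m) (Ks : (i : Fin m) → Complex (lookup ls i))
              {I J : Subset (sum ls)} → J ⊆ I → defect ls Ks J ⊆ defect ls Ks I
defect-mono ls Ks {I} {J} J⊆I {x} p =
  lookup⇒[]= x (defect ls Ks I)
    (trans (lookup∘tabulate _ x)
      (aux (face? (Ks x) (block ls J x)) (face? (Ks x) (block ls I x))
           (trans (sym (lookup∘tabulate _ x)) ([]=⇒lookup p))))
  where
    aux : (dJ : Dec (Face (Ks x) (block ls J x))) (dI : Dec (Face (Ks x) (block ls I x))) →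
          (if does dJ then outside else inside) ≡ inside →
          (if does dI then outside else inside) ≡ inside
    aux (yes _)  _        ()
    aux (no _)   (no _)   _ = refl
    aux (no ¬fJ) (yes fI) _ = ⊥-elim (¬fJ (closed (Ks x) (block-mono ls J⊆I x) fI))

compose : ∀ {m} (K : Complex m) (ls : Vec ℕ m) (Ks : (i : Fin m) → Complex (lookup ls i)) →
          Complex (sum ls)
compose K ls Ks = record
  { Face   = λ I → Face K (defect ls Ks I)
  ; face?  = λ I → face? K (defect ls Ks I)
  ; closed = λ J⊆I → closed K (defect-mono ls Ks J⊆I)
  }

-- Polynomials with integer coefficients, represented by their
-- coefficient sequences ℕ → ℤ (equality = equality of all coefficients).

Poly : Set
Poly = ℕ → ℤ

sumTo : ℕ → (ℕ → ℤ) → ℤ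
sumTo zero    f = f 0
sumTo (suc k) f = sumTo k f ℤ.+ f (suc k)

const : ℤ → Poly
const a zero    = a
const a (suc k) = 0ℤ

𝟙 : Poly
𝟙 = const 1ℤ

X : Poly
X zero          = 0ℤ
X (suc zero)    = 1ℤ
X (suc (suc k)) = 0ℤ

infixl 6 _⊕_ _⊖_
infixl 7 _⊛_

_⊕_ : Poly → Poly → Poly
(p ⊕ q) k = p k ℤ.+ q k

_⊖_ : Poly → Poly → Poly
(p ⊖ q) k = p k ℤ.- q k

_⊛_ : Poly → Poly → Poly
(p ⊛ q) k = sumTo k (λ i → p i ℤ.* q (k ∸ i))

_^^_ : Poly → ℕ → Poly
p ^^ zero  = 𝟙
p ^^ suc n = p ⊛ (p ^^ n)

ΣP : ℕ → (ℕ → Poly) → Poly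
ΣP d p k = sumTo d (λ i → p i k)

∏P : ∀ {m} → (Fin m → Poly) → Poly
∏P {zero}  p = 𝟙
∏P {suc m} p = p zero ⊛ ∏P (λ i → p (suc i))

-- With n = dimK K (dim K = n - 1),
--   h_K(t) = (1-t)^n f_K(t/(1-t)) = Σ_{i=0}^{n} f_i t^i (1-t)^{n-i},
--   q_K(t) = 1 - (1-t)^{m-n} h_K(t), m = number of vertices (with ghosts).

fpoly : ∀ {m} → Complex m → Poly
fpoly K = ΣP (dimK K) (λ i → const (ℤ.+ fvec K i) ⊛ (X ^^ i))

hpoly : ∀ {m} → Complex m → Poly
hpoly K = ΣP (dimK K) (λ i → const (ℤ.+ fvec K i) ⊛ (X ^^ i) ⊛ ((𝟙 ⊖ X) ^^ (dimK K ∸ i)))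

qpoly : ∀ {m} → Complex m → Poly
qpoly {m} K = 𝟙 ⊖ ((𝟙 ⊖ X) ^^ (m ∸ dimK K)) ⊛ hpoly K

-- Expanding h_K(t) = Σᵢ fᵢ tⁱ (1-t)^(n-i) shows that (1-t)^(m-n) h_K(t) is the
-- sum, over the simplices I of K, of the weight t^|I| (1-t)^(m-|I|) =
-- ∏_{v ∈ I} t · ∏_{v ∉ I} (1-t).  These weights of all subsets of [m] add up to
-- (t + (1-t))^m = 1, so q_K(t) is the total weight of the non-simplices of K.
-- A subset of [l₁] ⊔ ⋯ ⊔ [lₘ] is a non-simplex of ∂Δ_[m](K₁,…,Kₘ) exactly when
-- each of its blocks is a non-simplex of its Kᵢ, and the weight of a subset is
-- the product of the weights of its blocks; so the total weight factors.

module Submission where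

open import Defs
open import Data.Nat as ℕ using (ℕ; zero; suc; _∸_; _≤_; _⊔_; z≤n; s≤s)
import Data.Nat.Properties as ℕP
open import Data.Integer as ℤ using (ℤ; 0ℤ; 1ℤ)
import Data.Integer.Properties as ℤP
open import Data.Integer.Tactic.RingSolver using (solve-∀)
open import Data.Bool using (Bool; true; false; if_then_else_; not; _∧_)
import Data.Bool.Properties as BoolP
open import Data.Fin using (Fin; zero; suc)
open import Data.Fin.Subset using (Subset; inside; outside; ∣_∣; ⊤)
open import Data.Fin.Subset.Properties using (∣p∣≤n)
open import Data.Vec using (Vec; []; _∷_; lookup; sum)
open import Data.Vec.Properties using (≡-dec)
open import Data.List using (List; _++_; map; filter; length; foldr) renaming ([] to []ₗ; _∷_ to _∷ₗ_)
open import Data.List.Relation.Unary.All using (All) renaming ([] to []ₐ; _∷_ to _∷ₐ_)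
open import Data.Product using (_×_; _,_)
open import Data.Sum using (inj₁; inj₂)
open import Function using (_∘_; case_of_)
open import Level using (0ℓ)
open import Algebra.Bundles using (CommutativeMonoid)
import Algebra.Properties.CommutativeSemigroup as CommutativeSemigroupProperties
open import Relation.Binary.Bundles using (Setoid)
import Relation.Binary.Reasoning.Setoid as SetoidReasoning
open import Relation.Unary using (Pred; Decidable)
open import Relation.Nullary using (yes; no; does; _×-dec_)
open import Relation.Nullary.Decidable using (dec-true; dec-false)
open import Relation.Binary.PropositionalEquality

sumTo-cong-≤ : ∀ k {f g : ℕ → ℤ} → (∀ i → i ≤ k → f i ≡ g i) → sumTo k f ≡ sumTo k g
sumTo-cong-≤ zero    f≡g = f≡g 0 z≤n
sumTo-cong-≤ (suc k) f≡g =
  cong₂ ℤ._+_ (sumTo-cong-≤ k (λ i i≤k → f≡g i (ℕP.m≤n⇒m≤1+n i≤k))) (f≡g (suc k) ℕP.≤-refl)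

sumTo-cong : ∀ k {f g : ℕ → ℤ} → (∀ i → f i ≡ g i) → sumTo k f ≡ sumTo k g
sumTo-cong k f≡g = sumTo-cong-≤ k (λ i _ → f≡g i)

sumTo-zero : ∀ k {f : ℕ → ℤ} → (∀ i → i ≤ k → f i ≡ 0ℤ) → sumTo k f ≡ 0ℤ
sumTo-zero zero    f≡0 = f≡0 0 z≤n
sumTo-zero (suc k) f≡0 =
  cong₂ ℤ._+_ (sumTo-zero k (λ i i≤k → f≡0 i (ℕP.m≤n⇒m≤1+n i≤k))) (f≡0 (suc k) ℕP.≤-refl)

sumTo-distrib-+ : ∀ k (f g : ℕ → ℤ) → sumTo k (λ i → f i ℤ.+ g i) ≡ sumTo k f ℤ.+ sumTo k g
sumTo-distrib-+ zero    f g = refl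
sumTo-distrib-+ (suc k) f g =
  trans (cong (ℤ._+ (f (suc k) ℤ.+ g (suc k))) (sumTo-distrib-+ k f g))
        (interchange (sumTo k f) (sumTo k g) (f (suc k)) (g (suc k)))
  where
  interchange : ∀ a b c d → (a ℤ.+ b) ℤ.+ (c ℤ.+ d) ≡ (a ℤ.+ c) ℤ.+ (b ℤ.+ d)
  interchange = solve-∀

sumTo-*-distribˡ : ∀ k c (f : ℕ → ℤ) → sumTo k (λ i → c ℤ.* f i) ≡ c ℤ.* sumTo k f
sumTo-*-distribˡ zero    c f = refl
sumTo-*-distribˡ (suc k) c f =
  trans (cong (ℤ._+ (c ℤ.* f (suc k))) (sumTo-*-distribˡ k c f))
        (sym (ℤP.*-distribˡ-+ c (sumTo k f) (f (suc k))))

sumTo-suc : ∀ k (f : ℕ → ℤ) → sumTo (suc k) f ≡ f 0 ℤ.+ sumTo k (f ∘ suc)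
sumTo-suc zero    f = refl
sumTo-suc (suc k) f =
  trans (cong (ℤ._+ f (suc (suc k))) (sumTo-suc k f))
        (ℤP.+-assoc (f 0) (sumTo k (f ∘ suc)) (f (suc (suc k))))

sumTo-reverse : ∀ k (f : ℕ → ℤ) → sumTo k f ≡ sumTo k (λ i → f (k ∸ i))
sumTo-reverse zero    f = refl
sumTo-reverse (suc k) f = begin
  sumTo k f ℤ.+ f (suc k)                       ≡⟨ ℤP.+-comm (sumTo k f) (f (suc k)) ⟩
  f (suc k) ℤ.+ sumTo k f                       ≡⟨ cong (λ z → f (suc k) ℤ.+ z) (sumTo-reverse k f) ⟩
  f (suc k) ℤ.+ sumTo k (λ i → f (k ∸ i))       ≡⟨ sym (sumTo-suc k (λ i → f (suc k ∸ i))) ⟩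
  sumTo (suc k) (λ i → f (suc k ∸ i))           ∎
  where open ≡-Reasoning

sumTo-indicator : ∀ d {s} (a : ℤ) → s ≤ d → sumTo d (λ i → if does (s ℕ.≟ i) then a else 0ℤ) ≡ a
sumTo-indicator zero    a z≤n = refl
sumTo-indicator (suc d) {s} a s≤1+d with ℕP.m≤n⇒m<n∨m≡n s≤1+d
... | inj₁ (s≤s s≤d) =
  trans (cong₂ ℤ._+_ (sumTo-indicator d a s≤d) (cong (λ c → if c then a else 0ℤ) s≢1+d))
        (ℤP.+-identityʳ a)
  where
  s≢1+d : does (s ℕ.≟ suc d) ≡ false
  s≢1+d = dec-false (s ℕ.≟ suc d) (λ s≡1+d → ℕP.<-irrefl s≡1+d (s≤s s≤d))
... | inj₂ refl =
  trans (cong₂ ℤ._+_ (sumTo-zero d (λ i i≤d → cong (λ c → if c then a else 0ℤ) (1+d≢i i≤d)))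
                     (cong (λ c → if c then a else 0ℤ) (dec-true (suc d ℕ.≟ suc d) refl)))
        (ℤP.+-identityˡ a)
  where
  1+d≢i : ∀ {i} → i ≤ d → does (suc d ℕ.≟ i) ≡ false
  1+d≢i {i} i≤d = dec-false (suc d ℕ.≟ i) (λ 1+d≡i → ℕP.<-irrefl (sym 1+d≡i) (s≤s i≤d))

infix 4 _≐_
_≐_ : Poly → Poly → Set
p ≐ q = ∀ k → p k ≡ q k

≐-refl : ∀ {p} → p ≐ p
≐-refl k = refl

≐-sym : ∀ {p q} → p ≐ q → q ≐ p
≐-sym p≐q k = sym (p≐q k)

≐-trans : ∀ {p q r} → p ≐ q → q ≐ r → p ≐ r
≐-trans p≐q q≐r k = trans (p≐q k) (q≐r k)

Poly-setoid : Setoid 0ℓ 0ℓ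
Poly-setoid = record
  { Carrier = Poly ; _≈_ = _≐_
  ; isEquivalence = record { refl = ≐-refl ; sym = ≐-sym ; trans = ≐-trans } }

module ≐-Reasoning = SetoidReasoning Poly-setoid

𝟘 : Poly
𝟘 _ = 0ℤ

Y : Poly
Y = 𝟙 ⊖ X

scale : ℤ → Poly → Poly
scale c p k = c ℤ.* p k

shift : Poly → Poly
shift p k = p (suc k)

⊕-cong : ∀ {p p′ q q′} → p ≐ p′ → q ≐ q′ → p ⊕ q ≐ p′ ⊕ q′
⊕-cong p≐p′ q≐q′ k = cong₂ ℤ._+_ (p≐p′ k) (q≐q′ k)

⊕-identityʳ : ∀ p → p ⊕ 𝟘 ≐ p
⊕-identityʳ p k = ℤP.+-identityʳ (p k)

X⊕Y≐𝟙 : X ⊕ Y ≐ 𝟙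
X⊕Y≐𝟙 k = a+[b-a]≡b (X k) (𝟙 k)
  where
  a+[b-a]≡b : ∀ a b → a ℤ.+ (b ℤ.- a) ≡ b
  a+[b-a]≡b = solve-∀

⊛-congˡ : ∀ {p p′} q → p ≐ p′ → p ⊛ q ≐ p′ ⊛ q
⊛-congˡ q p≐p′ k = sumTo-cong k (λ i → cong (ℤ._* q (k ∸ i)) (p≐p′ i))

⊛-congʳ : ∀ p {q q′} → q ≐ q′ → p ⊛ q ≐ p ⊛ q′
⊛-congʳ p q≐q′ k = sumTo-cong k (λ i → cong (p i ℤ.*_) (q≐q′ (k ∸ i)))

⊛-distribʳ : ∀ p q r → (p ⊕ q) ⊛ r ≐ p ⊛ r ⊕ q ⊛ r
⊛-distribʳ p q r k =
  trans (sumTo-cong k (λ i → ℤP.*-distribʳ-+ (r (k ∸ i)) (p i) (q i))) (sumTo-distrib-+ k _ _)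

⊛-distribˡ : ∀ p q r → p ⊛ (q ⊕ r) ≐ p ⊛ q ⊕ p ⊛ r
⊛-distribˡ p q r k =
  trans (sumTo-cong k (λ i → ℤP.*-distribˡ-+ (p i) (q (k ∸ i)) (r (k ∸ i)))) (sumTo-distrib-+ k _ _)

⊛-scaleˡ : ∀ c p q → scale c p ⊛ q ≐ scale c (p ⊛ q)
⊛-scaleˡ c p q k =
  trans (sumTo-cong k (λ i → ℤP.*-assoc c (p i) (q (k ∸ i)))) (sumTo-*-distribˡ k c _)

𝟘-⊛ : ∀ p → 𝟘 ⊛ p ≐ 𝟘
𝟘-⊛ p k = sumTo-zero k (λ i _ → ℤP.*-zeroˡ (p (k ∸ i)))

⊛-suc : ∀ p q k → (p ⊛ q) (suc k) ≡ p 0 ℤ.* q (suc k) ℤ.+ (shift p ⊛ q) k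
⊛-suc p q k = sumTo-suc k (λ i → p i ℤ.* q (suc k ∸ i))

const-⊛ : ∀ c p → const c ⊛ p ≐ scale c p
const-⊛ c p zero    = refl
const-⊛ c p (suc k) =
  trans (⊛-suc (const c) p k)
        (trans (cong (λ z → c ℤ.* p (suc k) ℤ.+ z) (𝟘-⊛ p k)) (ℤP.+-identityʳ _))

⊛-identityˡ : ∀ p → 𝟙 ⊛ p ≐ p
⊛-identityˡ p k = trans (const-⊛ 1ℤ p k) (ℤP.*-identityˡ (p k))

-- Reversing the convolution sum turns p ⊛ q into q ⊛ p.
⊛-comm : ∀ p q → p ⊛ q ≐ q ⊛ p
⊛-comm p q k = trans (sumTo-reverse k _) (sumTo-cong-≤ k swap)
  where
  swap : ∀ i → i ≤ k → p (k ∸ i) ℤ.* q (k ∸ (k ∸ i)) ≡ q i ℤ.* p (k ∸ i)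
  swap i i≤k = trans (cong (λ j → p (k ∸ i) ℤ.* q j) (ℕP.m∸[m∸n]≡n i≤k))
                     (ℤP.*-comm (p (k ∸ i)) (q i))

⊛-assoc : ∀ p q r → (p ⊛ q) ⊛ r ≐ p ⊛ (q ⊛ r)
⊛-assoc p q r zero    = ℤP.*-assoc (p 0) (q 0) (r 0)
⊛-assoc p q r (suc k) = begin
  ((p ⊛ q) ⊛ r) (suc k)
    ≡⟨ ⊛-suc (p ⊛ q) r k ⟩
  p 0 ℤ.* q 0 ℤ.* r (suc k) ℤ.+ (shift (p ⊛ q) ⊛ r) k
    ≡⟨ cong (λ z → p 0 ℤ.* q 0 ℤ.* r (suc k) ℤ.+ z) shifted ⟩
  p 0 ℤ.* q 0 ℤ.* r (suc k) ℤ.+ (p 0 ℤ.* (shift q ⊛ r) k ℤ.+ (shift p ⊛ (q ⊛ r)) k)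
    ≡⟨ regroup (p 0) (q 0) (r (suc k)) ((shift q ⊛ r) k) ((shift p ⊛ (q ⊛ r)) k) ⟩
  p 0 ℤ.* (q 0 ℤ.* r (suc k) ℤ.+ (shift q ⊛ r) k) ℤ.+ (shift p ⊛ (q ⊛ r)) k
    ≡⟨ cong (λ a → p 0 ℤ.* a ℤ.+ (shift p ⊛ (q ⊛ r)) k) (sym (⊛-suc q r k)) ⟩
  p 0 ℤ.* (q ⊛ r) (suc k) ℤ.+ (shift p ⊛ (q ⊛ r)) k
    ≡⟨ sym (⊛-suc p (q ⊛ r) k) ⟩
  (p ⊛ (q ⊛ r)) (suc k) ∎
  where
  open ≡-Reasoning
  shift-⊛ : shift (p ⊛ q) ≐ scale (p 0) (shift q) ⊕ shift p ⊛ q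
  shift-⊛ = ⊛-suc p q
  shifted : (shift (p ⊛ q) ⊛ r) k ≡ p 0 ℤ.* (shift q ⊛ r) k ℤ.+ (shift p ⊛ (q ⊛ r)) k
  shifted = trans (⊛-congˡ r shift-⊛ k)
           (trans (⊛-distribʳ (scale (p 0) (shift q)) (shift p ⊛ q) r k)
                  (cong₂ ℤ._+_ (⊛-scaleˡ (p 0) (shift q) r k) (⊛-assoc (shift p) q r k)))
  regroup : ∀ a b c d e → a ℤ.* b ℤ.* c ℤ.+ (a ℤ.* d ℤ.+ e) ≡ a ℤ.* (b ℤ.* c ℤ.+ d) ℤ.+ e
  regroup = solve-∀

⊛-commutativeMonoid : CommutativeMonoid 0ℓ 0ℓ
⊛-commutativeMonoid = record
  { Carrier = Poly ; _≈_ = _≐_ ; _∙_ = _⊛_ ; ε = 𝟙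
  ; isCommutativeMonoid = record
    { isMonoid = record
      { isSemigroup = record
        { isMagma = record
          { isEquivalence = Setoid.isEquivalence Poly-setoid
          ; ∙-cong = λ {p} {p′} {q} {q′} p≐p′ q≐q′ →
                       ≐-trans (⊛-congˡ q p≐p′) (⊛-congʳ p′ q≐q′) }
        ; assoc = ⊛-assoc }
      ; identity = ⊛-identityˡ , λ p → ≐-trans (⊛-comm p 𝟙) (⊛-identityˡ p) }
    ; comm = ⊛-comm } }

open CommutativeSemigroupProperties (CommutativeMonoid.commutativeSemigroup ⊛-commutativeMonoid)
  using (x∙yz≈y∙xz)

^^-+ : ∀ p a b → p ^^ a ⊛ p ^^ b ≐ p ^^ (a ℕ.+ b)
^^-+ p zero    b = ⊛-identityˡ (p ^^ b)
^^-+ p (suc a) b = ≐-trans (⊛-assoc p (p ^^ a) (p ^^ b)) (⊛-congʳ p (^^-+ p a b))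

⊛-ΣP : ∀ p d g → p ⊛ ΣP d g ≐ ΣP d (λ i → p ⊛ g i)
⊛-ΣP p zero    g = ≐-refl
⊛-ΣP p (suc d) g = ≐-trans (⊛-distribˡ p (ΣP d g) (g (suc d))) (⊕-cong (⊛-ΣP p d g) (≐-refl {p ⊛ g (suc d)}))

ΣP-cong-≤ : ∀ d {g g′ : ℕ → Poly} → (∀ i → i ≤ d → g i ≐ g′ i) → ΣP d g ≐ ΣP d g′
ΣP-cong-≤ d g≐g′ k = sumTo-cong-≤ d (λ i i≤d → g≐g′ i i≤d k)

∏P-cong : ∀ {m} {p p′ : Fin m → Poly} → (∀ i → p i ≐ p′ i) → ∏P p ≐ ∏P p′
∏P-cong {zero}  p≐p′ = ≐-refl
∏P-cong {suc m} {p} {p′} p≐p′ =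
  ≐-trans (⊛-congˡ (∏P (p ∘ suc)) (p≐p′ zero)) (⊛-congʳ (p′ zero) (∏P-cong (p≐p′ ∘ suc)))

-- Weights of subsets: a vertex contributes t if it lies in I and 1 - t otherwise

factor : Bool → Poly
factor true  = X
factor false = Y

weight : ∀ {n} → Subset n → Poly
weight []      = 𝟙
weight (x ∷ I) = factor x ⊛ weight I

weightSum : ∀ {n} → (Subset n → Bool) → List (Subset n) → Poly
weightSum b []ₗ      = 𝟘
weightSum b (I ∷ₗ L) = if b I then weight I ⊕ weightSum b L else weightSum b L

weightOf : ∀ {n} → (Subset n → Bool) → Poly
weightOf {n} b = weightSum b (allSubsets n)

weight≐X^card⊛Y^cocard : ∀ {n} (I : Subset n) → weight I ≐ X ^^ ∣ I ∣ ⊛ Y ^^ (n ∸ ∣ I ∣)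
weight≐X^card⊛Y^cocard [] = ≐-sym (⊛-identityˡ 𝟙)
weight≐X^card⊛Y^cocard {suc n} (true ∷ I) =
  ≐-trans (⊛-congʳ X (weight≐X^card⊛Y^cocard I)) (≐-sym (⊛-assoc X (X ^^ ∣ I ∣) (Y ^^ (n ∸ ∣ I ∣))))
weight≐X^card⊛Y^cocard {suc n} (false ∷ I) = begin
  Y ⊛ weight I                         ≈⟨ ⊛-congʳ Y (weight≐X^card⊛Y^cocard I) ⟩
  Y ⊛ (X ^^ ∣ I ∣ ⊛ Y ^^ (n ∸ ∣ I ∣))  ≈⟨ x∙yz≈y∙xz Y (X ^^ ∣ I ∣) (Y ^^ (n ∸ ∣ I ∣)) ⟩
  X ^^ ∣ I ∣ ⊛ Y ^^ suc (n ∸ ∣ I ∣)    ≡⟨ cong (λ e → X ^^ ∣ I ∣ ⊛ Y ^^ e) (sym (ℕP.+-∸-assoc 1 (∣p∣≤n I))) ⟩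
  X ^^ ∣ I ∣ ⊛ Y ^^ (suc n ∸ ∣ I ∣)    ∎
  where open ≐-Reasoning

weightSum-∷ : ∀ {n} (b : Subset n → Bool) I L k →
  weightSum b (I ∷ₗ L) k ≡ (if b I then weight I k else 0ℤ) ℤ.+ weightSum b L k
weightSum-∷ b I L k with b I
... | true  = refl
... | false = sym (ℤP.+-identityˡ _)

weightSum-++ : ∀ {n} (b : Subset n → Bool) L M → weightSum b (L ++ M) ≐ weightSum b L ⊕ weightSum b M
weightSum-++ b []ₗ      M k = sym (ℤP.+-identityˡ _)
weightSum-++ b (I ∷ₗ L) M k with b I
... | true  = trans (cong (λ z → weight I k ℤ.+ z) (weightSum-++ b L M k)) (sym (ℤP.+-assoc (weight I k) _ _))
... | false = weightSum-++ b L M k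

weightSum-map-∷ : ∀ {n} (b : Subset (suc n) → Bool) x L →
  weightSum b (map (x ∷_) L) ≐ factor x ⊛ weightSum (b ∘ (x ∷_)) L
weightSum-map-∷ b x []ₗ = ≐-sym (≐-trans (⊛-comm (factor x) 𝟘) (𝟘-⊛ (factor x)))
weightSum-map-∷ b x (I ∷ₗ L) with b (x ∷ I)
... | true  = ≐-trans (⊕-cong (≐-refl {factor x ⊛ weight I}) (weightSum-map-∷ b x L))
                      (≐-sym (⊛-distribˡ (factor x) (weight I) (weightSum (b ∘ (x ∷_)) L)))
... | false = weightSum-map-∷ b x L

weightSum-cong : ∀ {n} {b b′ : Subset n → Bool} → (∀ I → b I ≡ b′ I) → ∀ L → weightSum b L ≐ weightSum b′ L
weightSum-cong b≡b′ []ₗ = ≐-refl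
weightSum-cong {b = b} {b′} b≡b′ (I ∷ₗ L) with b I | b′ I | b≡b′ I
... | true  | true  | refl = ⊕-cong (≐-refl {weight I}) (weightSum-cong b≡b′ L)
... | false | false | refl = weightSum-cong b≡b′ L

weightSum-false : ∀ {n} L → weightSum {n} (λ _ → false) L ≐ 𝟘
weightSum-false []ₗ      = ≐-refl
weightSum-false (I ∷ₗ L) = weightSum-false L

weightSum-⊕-not : ∀ {n} (b : Subset n → Bool) L →
  weightSum b L ⊕ weightSum (not ∘ b) L ≐ weightSum (λ _ → true) L
weightSum-⊕-not b []ₗ k = refl
weightSum-⊕-not b (I ∷ₗ L) k with b I
... | true  = trans (ℤP.+-assoc (weight I k) _ _) (cong (λ z → weight I k ℤ.+ z) (weightSum-⊕-not b L k))
... | false = trans (a+[b+c]≡b+[a+c] (weightSum b L k) (weight I k) _)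
                    (cong (λ z → weight I k ℤ.+ z) (weightSum-⊕-not b L k))
  where
  a+[b+c]≡b+[a+c] : ∀ a b c → a ℤ.+ (b ℤ.+ c) ≡ b ℤ.+ (a ℤ.+ c)
  a+[b+c]≡b+[a+c] = solve-∀

weightOf-suc : ∀ {n} (b : Subset (suc n) → Bool) →
  weightOf b ≐ X ⊛ weightOf (b ∘ (inside ∷_)) ⊕ Y ⊛ weightOf (b ∘ (outside ∷_))
weightOf-suc {n} b =
  ≐-trans (weightSum-++ b (map (inside ∷_) (allSubsets n)) (map (outside ∷_) (allSubsets n)))
          (⊕-cong (weightSum-map-∷ b inside (allSubsets n)) (weightSum-map-∷ b outside (allSubsets n)))

weightOf-all : ∀ n → weightOf {n} (λ _ → true) ≐ 𝟙
weightOf-all zero    = ⊕-identityʳ 𝟙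
weightOf-all (suc n) = begin
  weightOf {suc n} (λ _ → true)  ≈⟨ weightOf-suc {n} (λ _ → true) ⟩
  X ⊛ W ⊕ Y ⊛ W                  ≈⟨ ≐-sym (⊛-distribʳ X Y W) ⟩
  (X ⊕ Y) ⊛ W                    ≈⟨ ⊛-congˡ W X⊕Y≐𝟙 ⟩
  𝟙 ⊛ W                          ≈⟨ ⊛-identityˡ W ⟩
  W                              ≈⟨ weightOf-all n ⟩
  𝟙                              ∎
  where
  open ≐-Reasoning
  W : Poly
  W = weightOf {n} (λ _ → true)

weightOf-split : ∀ l {n} (b₁ : Subset l → Bool) (b₂ : Subset n → Bool) →
  weightOf (λ I → b₁ (splitL l I) ∧ b₂ (splitR l I)) ≐ weightOf b₁ ⊛ weightOf b₂
weightOf-split zero {n} b₁ b₂ with b₁ []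
... | true  = ≐-sym (≐-trans (⊛-congˡ (weightOf b₂) (⊕-identityʳ 𝟙)) (⊛-identityˡ (weightOf b₂)))
... | false = ≐-trans (weightSum-false (allSubsets n)) (≐-sym (𝟘-⊛ (weightOf b₂)))
weightOf-split (suc l) {n} b₁ b₂ = begin
  weightOf (λ I → b₁ (splitL (suc l) I) ∧ b₂ (splitR (suc l) I))
    ≈⟨ weightOf-suc {l ℕ.+ n} (λ I → b₁ (splitL (suc l) I) ∧ b₂ (splitR (suc l) I)) ⟩
  X ⊛ weightOf (λ I → b₁ (inside ∷ splitL l I) ∧ b₂ (splitR l I))
    ⊕ Y ⊛ weightOf (λ I → b₁ (outside ∷ splitL l I) ∧ b₂ (splitR l I))
    ≈⟨ ⊕-cong (⊛-congʳ X (weightOf-split l (b₁ ∘ (inside ∷_)) b₂))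
              (⊛-congʳ Y (weightOf-split l (b₁ ∘ (outside ∷_)) b₂)) ⟩
  X ⊛ (W₁ ⊛ W₂) ⊕ Y ⊛ (W₀ ⊛ W₂)  ≈⟨ ≐-sym (⊕-cong (⊛-assoc X W₁ W₂) (⊛-assoc Y W₀ W₂)) ⟩
  X ⊛ W₁ ⊛ W₂ ⊕ Y ⊛ W₀ ⊛ W₂      ≈⟨ ≐-sym (⊛-distribʳ (X ⊛ W₁) (Y ⊛ W₀) W₂) ⟩
  (X ⊛ W₁ ⊕ Y ⊛ W₀) ⊛ W₂          ≈⟨ ⊛-congˡ W₂ (≐-sym (weightOf-suc b₁)) ⟩
  weightOf b₁ ⊛ W₂                ∎
  where
  open ≐-Reasoning
  W₁ W₀ W₂ : Poly
  W₁ = weightOf (b₁ ∘ (inside ∷_))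
  W₀ = weightOf (b₁ ∘ (outside ∷_))
  W₂ = weightOf b₂

-- The h-polynomial and the q-polynomial as weights

weightSum-uniform : ∀ {n ℓ} {P : Pred (Subset n) ℓ} (P? : Decidable P) (p : Poly) L →
  (∀ I → P I → weight I ≐ p) → weightSum (does ∘ P?) L ≐ scale (ℤ.+ length (filter P? L)) p
weightSum-uniform P? p []ₗ     _ k = sym (ℤP.*-zeroˡ (p k))
weightSum-uniform P? p (I ∷ₗ L) w≐p k with P? I
... | yes PI = trans (cong₂ ℤ._+_ (w≐p I PI k) (weightSum-uniform P? p L w≐p k))
                     (sym (ℤP.suc-* (ℤ.+ length (filter P? L)) (p k)))
... | no  _  = weightSum-uniform P? p L w≐p k

weightSum-byCard : ∀ {n} (b : Subset n → Bool) d L → All (λ I → b I ≡ true → ∣ I ∣ ≤ d) L →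
  ΣP d (λ i → weightSum (λ I → b I ∧ does (∣ I ∣ ℕ.≟ i)) L) ≐ weightSum b L
weightSum-byCard b d []ₗ _ k = sumTo-zero d (λ _ _ → refl)
weightSum-byCard b d (I ∷ₗ L) (bounded ∷ₐ boundedL) k = begin
  sumTo d (λ i → weightSum (λ J → b J ∧ does (∣ J ∣ ℕ.≟ i)) (I ∷ₗ L) k)
    ≡⟨ trans (sumTo-cong d (λ i → weightSum-∷ (λ J → b J ∧ does (∣ J ∣ ℕ.≟ i)) I L k)) (sumTo-distrib-+ d _ _) ⟩
  sumTo d (λ i → if b I ∧ does (∣ I ∣ ℕ.≟ i) then weight I k else 0ℤ)
    ℤ.+ sumTo d (λ i → weightSum (λ J → b J ∧ does (∣ J ∣ ℕ.≟ i)) L k)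
    ≡⟨ cong₂ ℤ._+_ (countI (b I) bounded) (weightSum-byCard b d L boundedL k) ⟩
  (if b I then weight I k else 0ℤ) ℤ.+ weightSum b L k
    ≡⟨ sym (weightSum-∷ b I L k) ⟩
  weightSum b (I ∷ₗ L) k ∎
  where
  open ≡-Reasoning
  countI : ∀ c → (c ≡ true → ∣ I ∣ ≤ d) →
    sumTo d (λ i → if c ∧ does (∣ I ∣ ℕ.≟ i) then weight I k else 0ℤ) ≡ (if c then weight I k else 0ℤ)
  countI true  bound = sumTo-indicator d (weight I k) (bound refl)
  countI false _     = sumTo-zero d (λ _ _ → refl)

dimK≤n : ∀ {n} (K : Complex n) → dimK K ≤ n
dimK≤n K = maxCard≤n (faces K)
  where
  maxCard≤n : ∀ {n} (L : List (Subset n)) → foldr (λ I r → ∣ I ∣ ⊔ r) 0 L ≤ n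
  maxCard≤n []ₗ      = z≤n
  maxCard≤n (I ∷ₗ L) = ℕP.⊔-lub (∣p∣≤n I) (maxCard≤n L)

faces-card≤ : ∀ {n} (K : Complex n) d L → foldr (λ I r → ∣ I ∣ ⊔ r) 0 (filter (face? K) L) ≤ d →
  All (λ I → does (face? K I) ≡ true → ∣ I ∣ ≤ d) L
faces-card≤ K d []ₗ      _ = []ₐ
faces-card≤ K d (I ∷ₗ L) bound with does (face? K I) in isFace
... | true  = (λ _ → ℕP.m⊔n≤o⇒m≤o ∣ I ∣ _ bound) ∷ₐ faces-card≤ K d L (ℕP.m⊔n≤o⇒n≤o ∣ I ∣ _ bound)
... | false = (λ isFace′ → case trans (sym isFace) isFace′ of λ ()) ∷ₐ faces-card≤ K d L bound

hSummand≐weightOf : ∀ {n} (K : Complex n) i → i ≤ dimK K →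
  Y ^^ (n ∸ dimK K) ⊛ (const (ℤ.+ fvec K i) ⊛ X ^^ i ⊛ Y ^^ (dimK K ∸ i))
    ≐ weightOf (λ I → does (face? K I) ∧ does (∣ I ∣ ℕ.≟ i))
hSummand≐weightOf {n} K i i≤d = begin
  Y ^^ (n ∸ d) ⊛ (C ⊛ X ^^ i ⊛ Y ^^ (d ∸ i))  ≈⟨ x∙yz≈y∙xz (Y ^^ (n ∸ d)) (C ⊛ X ^^ i) (Y ^^ (d ∸ i)) ⟩
  C ⊛ X ^^ i ⊛ (Y ^^ (n ∸ d) ⊛ Y ^^ (d ∸ i))  ≈⟨ ⊛-congʳ (C ⊛ X ^^ i) (^^-+ Y (n ∸ d) (d ∸ i)) ⟩
  C ⊛ X ^^ i ⊛ Y ^^ (n ∸ d ℕ.+ (d ∸ i))       ≡⟨ cong (λ e → C ⊛ X ^^ i ⊛ Y ^^ e) exponent ⟩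
  C ⊛ X ^^ i ⊛ Y ^^ (n ∸ i)                    ≈⟨ ⊛-assoc C (X ^^ i) (Y ^^ (n ∸ i)) ⟩
  C ⊛ (X ^^ i ⊛ Y ^^ (n ∸ i))                  ≈⟨ const-⊛ (ℤ.+ fvec K i) (X ^^ i ⊛ Y ^^ (n ∸ i)) ⟩
  scale (ℤ.+ fvec K i) (X ^^ i ⊛ Y ^^ (n ∸ i))
    ≈⟨ ≐-sym (weightSum-uniform (λ I → face? K I ×-dec (∣ I ∣ ℕ.≟ i)) (X ^^ i ⊛ Y ^^ (n ∸ i)) (allSubsets n) weight-card≡i) ⟩
  weightOf (λ I → does (face? K I) ∧ does (∣ I ∣ ℕ.≟ i)) ∎
  where
  open ≐-Reasoning
  d : ℕ
  d = dimK K
  C : Poly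
  C = const (ℤ.+ fvec K i)
  exponent : n ∸ d ℕ.+ (d ∸ i) ≡ n ∸ i
  exponent = trans (sym (ℕP.+-∸-assoc (n ∸ d) i≤d)) (cong (_∸ i) (ℕP.m∸n+n≡m (dimK≤n K)))
  weight-card≡i : ∀ I → Face K I × ∣ I ∣ ≡ i → weight I ≐ X ^^ i ⊛ Y ^^ (n ∸ i)
  weight-card≡i I (_ , ∣I∣≡i) rewrite sym ∣I∣≡i = weight≐X^card⊛Y^cocard I

hpoly≐weightOf-face : ∀ {n} (K : Complex n) → Y ^^ (n ∸ dimK K) ⊛ hpoly K ≐ weightOf (does ∘ face? K)
hpoly≐weightOf-face {n} K =
  ≐-trans (⊛-ΣP (Y ^^ (n ∸ dimK K)) (dimK K) (λ i → const (ℤ.+ fvec K i) ⊛ X ^^ i ⊛ Y ^^ (dimK K ∸ i)))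
  (≐-trans (ΣP-cong-≤ (dimK K) (hSummand≐weightOf K))
           (weightSum-byCard (does ∘ face? K) (dimK K) (allSubsets n)
                             (faces-card≤ K (dimK K) (allSubsets n) ℕP.≤-refl)))

nonFace : ∀ {n} → Complex n → Subset n → Bool
nonFace K = not ∘ does ∘ face? K

qpoly≐weightOf-nonFace : ∀ {n} (K : Complex n) → qpoly K ≐ weightOf (nonFace K)
qpoly≐weightOf-nonFace {n} K k = begin
  𝟙 k ℤ.- (Y ^^ (n ∸ dimK K) ⊛ hpoly K) k   ≡⟨ cong (λ z → 𝟙 k ℤ.- z) (hpoly≐weightOf-face K k) ⟩
  𝟙 k ℤ.- F                                 ≡⟨ cong (ℤ._- F) (sym faces+nonFaces≡1) ⟩
  (F ℤ.+ weightOf (nonFace K) k) ℤ.- F      ≡⟨ [a+b]-a≡b F _ ⟩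
  weightOf (nonFace K) k                    ∎
  where
  open ≡-Reasoning
  F : ℤ
  F = weightOf (does ∘ face? K) k
  faces+nonFaces≡1 : F ℤ.+ weightOf (nonFace K) k ≡ 𝟙 k
  faces+nonFaces≡1 = trans (weightSum-⊕-not (does ∘ face? K) (allSubsets n) k) (weightOf-all n k)
  [a+b]-a≡b : ∀ a b → (a ℤ.+ b) ℤ.- a ≡ b
  [a+b]-a≡b = solve-∀

-- Composition with the boundary of the simplex

allBlocksNonFace : ∀ {m} (ls : Vec ℕ m) (Ks : (i : Fin m) → Complex (lookup ls i)) → Subset (sum ls) → Bool
allBlocksNonFace []       Ks I = true
allBlocksNonFace (l ∷ ls) Ks I = nonFace (Ks zero) (splitL l I) ∧ allBlocksNonFace ls (Ks ∘ suc) (splitR l I)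

nonFace-compose-∂Δ : ∀ {m} (ls : Vec ℕ m) (Ks : (i : Fin m) → Complex (lookup ls i)) I →
  nonFace (compose (∂Δ m) ls Ks) I ≡ allBlocksNonFace ls Ks I
nonFace-compose-∂Δ ls Ks I = trans (BoolP.not-involutive _) (defect≡⊤ ls Ks I)
  where
  inside-iff-not : ∀ c → does ((if c then outside else inside) BoolP.≟ inside) ≡ not c
  inside-iff-not true  = refl
  inside-iff-not false = refl
  defect≡⊤ : ∀ {m} (ls : Vec ℕ m) (Ks : (i : Fin m) → Complex (lookup ls i)) I →
    does (≡-dec BoolP._≟_ (defect ls Ks I) ⊤) ≡ allBlocksNonFace ls Ks I
  defect≡⊤ []       Ks I = refl
  defect≡⊤ (l ∷ ls) Ks I =
    cong₂ _∧_ (inside-iff-not (does (face? (Ks zero) (splitL l I)))) (defect≡⊤ ls (Ks ∘ suc) (splitR l I))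

weightOf-allBlocksNonFace : ∀ {m} (ls : Vec ℕ m) (Ks : (i : Fin m) → Complex (lookup ls i)) →
  weightOf (allBlocksNonFace ls Ks) ≐ ∏P (λ i → weightOf (nonFace (Ks i)))
weightOf-allBlocksNonFace []       Ks = weightOf-all 0
weightOf-allBlocksNonFace (l ∷ ls) Ks =
  ≐-trans (weightOf-split l (nonFace (Ks zero)) (allBlocksNonFace ls (Ks ∘ suc)))
          (⊛-congʳ (weightOf (nonFace (Ks zero))) (weightOf-allBlocksNonFace ls (Ks ∘ suc)))

mainTheorem16 : ∀ {m} (ls : Vec ℕ m) (Ks : (i : Fin m) → Complex (lookup ls i)) →
                ∀ k → qpoly (compose (∂Δ m) ls Ks) k ≡ ∏P (λ i → qpoly (Ks i)) k
mainTheorem16 {m} ls Ks = begin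
  qpoly (compose (∂Δ m) ls Ks)                  ≈⟨ qpoly≐weightOf-nonFace (compose (∂Δ m) ls Ks) ⟩
  weightOf (nonFace (compose (∂Δ m) ls Ks))     ≈⟨ weightSum-cong (nonFace-compose-∂Δ ls Ks) (allSubsets (sum ls)) ⟩
  weightOf (allBlocksNonFace ls Ks)             ≈⟨ weightOf-allBlocksNonFace ls Ks ⟩
  ∏P (λ i → weightOf (nonFace (Ks i)))          ≈⟨ ∏P-cong (λ i → ≐-sym (qpoly≐weightOf-nonFace (Ks i))) ⟩
  ∏P (λ i → qpoly (Ks i))                       ∎
  where open ≐-Reasoning
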